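{- Let $\mathbf A\in\mathbf{I}_{2,0}$. Then the relation $\sqsubseteq$ is transitive on $A$: if $a\sqsubseteq b$ and $b\sqsubseteq c$ then $a\sqsubseteq c$.
   Context: A zroupoid is an algebra $\langle A,\to,0\rangle$ with binary $\to$ and constant $0$; $x':=x\to 0$. An implication zroupoid satisfies (I) $(x\to y)\to z\approx[(z'\to x)\to(y\to z)']'$ and $0''\approx 0$; $\mathbf{I}_{2,0}$ is the variety of implication zroupoids satisfying $x''\approx x$. For $x,y\in A$, $x\sqsubseteq y$ iff $(x\to y')'=x$. -}

module Defs where

open import Level using (Level; suc)
open import Relation.Binary.PropositionalEquality using (_≡_)

record Zroupoid (a : Level) : Set (suc a) where
  field
    Carrier : Set a
    _⇒_     : Carrier → Carrier → Carrier
    𝟎       : Carrier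

  infixr 5 _⇒_

  _′ : Carrier → Carrier
  x ′ = x ⇒ 𝟎

  infix 8 _′

  _⊑_ : Carrier → Carrier → Set a
  x ⊑ y = ((x ⇒ (y ′)) ′) ≡ x

record IsImplicationZroupoid {a : Level} (Z : Zroupoid a) : Set a where
  open Zroupoid Z
  field
    identityI : ∀ x y z → ((x ⇒ y) ⇒ z) ≡ (((z ′) ⇒ x) ⇒ ((y ⇒ z) ′)) ′
    zero″     : (𝟎 ′) ′ ≡ 𝟎

record IsI₂₀ {a : Level} (Z : Zroupoid a) : Set a where
  open Zroupoid Z
  field
    isImplicationZroupoid : IsImplicationZroupoid Z
    involution            : ∀ x → (x ′) ′ ≡ x

module Submission where

open import Defs
open import Level using (Level)
open import Relation.Binary.PropositionalEquality using (_≡_; sym; trans; cong; module ≡-Reasoning)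

module I₂₀-Laws {ℓ : Level} (A : Zroupoid ℓ) (isI₂₀ : IsI₂₀ A) where
  open Zroupoid A
  open IsI₂₀ isI₂₀
  open IsImplicationZroupoid isImplicationZroupoid
  open ≡-Reasoning

  I-𝟎ˡ : ∀ x y → (𝟎 ⇒ x) ⇒ y ≡ (y ⇒ (x ⇒ y) ′) ′
  I-𝟎ˡ x y = begin
    (𝟎 ⇒ x) ⇒ y
      ≡⟨ identityI 𝟎 x y ⟩
    (y ′ ′ ⇒ (x ⇒ y) ′) ′
      ≡⟨ cong (λ □ → (□ ⇒ (x ⇒ y) ′) ′) (involution y) ⟩
    (y ⇒ (x ⇒ y) ′) ′ ∎

  I-𝟎ʳ : ∀ x y → (x ⇒ y) ′ ≡ ((𝟎 ′ ⇒ x) ⇒ y) ′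
  I-𝟎ʳ x y = begin
    (x ⇒ y) ′
      ≡⟨ identityI x y 𝟎 ⟩
    ((𝟎 ′ ⇒ x) ⇒ y ′ ′) ′
      ≡⟨ cong (λ □ → ((𝟎 ′ ⇒ x) ⇒ □) ′) (involution y) ⟩
    ((𝟎 ′ ⇒ x) ⇒ y) ′ ∎

  I-reversed : ∀ x y z → (x ′ ⇒ y) ⇒ (z ⇒ x) ′ ≡ ((y ⇒ z) ⇒ x) ′
  I-reversed x y z = begin
    (x ′ ⇒ y) ⇒ (z ⇒ x) ′
      ≡⟨ sym (involution ((x ′ ⇒ y) ⇒ (z ⇒ x) ′)) ⟩
    ((x ′ ⇒ y) ⇒ (z ⇒ x) ′) ′ ′
      ≡⟨ cong _′ (sym (identityI y z x)) ⟩
    ((y ⇒ z) ⇒ x) ′ ∎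

  I-reversed-𝟎 : ∀ x y → x ⇒ (y ⇒ x) ′ ≡ ((𝟎 ⇒ y) ⇒ x) ′
  I-reversed-𝟎 x y = begin
    x ⇒ (y ⇒ x) ′
      ≡⟨ cong (λ □ → □ ⇒ (y ⇒ x) ′) (sym (involution x)) ⟩
    x ′ ′ ⇒ (y ⇒ x) ′
      ≡⟨ I-reversed x 𝟎 y ⟩
    ((𝟎 ⇒ y) ⇒ x) ′ ∎

  I-𝟎′-middle : ∀ x y → (x ⇒ 𝟎 ′) ⇒ y ≡ ((y ′ ⇒ x) ⇒ y ′) ′
  I-𝟎′-middle x y = begin
    (x ⇒ 𝟎 ′) ⇒ y
      ≡⟨ identityI x (𝟎 ′) y ⟩
    ((y ′ ⇒ x) ⇒ (𝟎 ′ ⇒ y) ′) ′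
      ≡⟨ cong (λ □ → ((y ′ ⇒ x) ⇒ ((𝟎 ′ ⇒ y) ⇒ □)) ′) (sym (involution 𝟎)) ⟩
    ((y ′ ⇒ x) ⇒ ((𝟎 ′ ⇒ y) ⇒ 𝟎 ′ ′)) ′
      ≡⟨ cong (λ □ → ((y ′ ⇒ x) ⇒ □) ′) (I-reversed 𝟎 y 𝟎) ⟩
    ((y ′ ⇒ x) ⇒ y ′ ′ ′) ′
      ≡⟨ cong (λ □ → ((y ′ ⇒ x) ⇒ □) ′) (involution (y ′)) ⟩
    ((y ′ ⇒ x) ⇒ y ′) ′ ∎

  ⇒-absorbs-𝟎⇒ : ∀ x → x ⇒ (𝟎 ⇒ x) ′ ≡ x ′
  ⇒-absorbs-𝟎⇒ x = begin
    x ⇒ (𝟎 ⇒ x) ′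
      ≡⟨ I-reversed-𝟎 x 𝟎 ⟩
    (𝟎 ′ ⇒ x) ′
      ≡⟨ cong (λ □ → (𝟎 ′ ⇒ x) ⇒ □) (sym (involution 𝟎)) ⟩
    (𝟎 ′ ⇒ x) ⇒ 𝟎 ′ ′
      ≡⟨ I-reversed 𝟎 x 𝟎 ⟩
    x ′ ′ ′
      ≡⟨ involution (x ′) ⟩
    x ′ ∎

  𝟎′-unit : ∀ x → 𝟎 ′ ⇒ x ≡ x
  𝟎′-unit x = begin
    𝟎 ′ ⇒ x
      ≡⟨ sym (involution (𝟎 ′ ⇒ x)) ⟩
    (𝟎 ′ ⇒ x) ′ ′
      ≡⟨ sym (I-𝟎ʳ x 𝟎) ⟩
    x ′ ′
      ≡⟨ involution x ⟩
    x ∎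

  𝟎⇒𝟎′ : 𝟎 ⇒ 𝟎 ′ ≡ 𝟎 ′
  𝟎⇒𝟎′ = begin
    𝟎 ⇒ 𝟎 ′
      ≡⟨ sym (involution (𝟎 ⇒ 𝟎 ′)) ⟩
    (𝟎 ⇒ 𝟎 ′) ′ ′
      ≡⟨ cong (λ □ → ((𝟎 ⇒ 𝟎 ′) ⇒ □) ′) (sym (involution 𝟎)) ⟩
    ((𝟎 ⇒ 𝟎 ′) ⇒ 𝟎 ′ ′) ′
      ≡⟨ cong (λ □ → ((□ ⇒ 𝟎 ′) ⇒ 𝟎 ′ ′) ′) (sym (involution 𝟎)) ⟩
    ((𝟎 ′ ′ ⇒ 𝟎 ′) ⇒ 𝟎 ′ ′) ′
      ≡⟨ sym (I-𝟎′-middle (𝟎 ′) (𝟎 ′)) ⟩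
    (𝟎 ′ ⇒ 𝟎 ′) ⇒ 𝟎 ′
      ≡⟨ cong (λ □ → □ ⇒ 𝟎 ′) (𝟎′-unit (𝟎 ′)) ⟩
    𝟎 ′ ⇒ 𝟎 ′
      ≡⟨ 𝟎′-unit (𝟎 ′) ⟩
    𝟎 ′ ∎

  contra-𝟎 : ∀ x → x ′ ⇒ 𝟎 ′ ≡ 𝟎 ⇒ x
  contra-𝟎 x = begin
    x ′ ⇒ 𝟎 ′
      ≡⟨ identityI x 𝟎 (𝟎 ′) ⟩
    ((𝟎 ′ ′ ⇒ x) ⇒ (𝟎 ⇒ 𝟎 ′) ′) ′
      ≡⟨ cong (λ □ → ((□ ⇒ x) ⇒ (𝟎 ⇒ 𝟎 ′) ′) ′) (involution 𝟎) ⟩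
    ((𝟎 ⇒ x) ⇒ (𝟎 ⇒ 𝟎 ′) ′) ′
      ≡⟨ cong (λ □ → ((𝟎 ⇒ x) ⇒ □ ′) ′) 𝟎⇒𝟎′ ⟩
    ((𝟎 ⇒ x) ⇒ 𝟎 ′ ′) ′
      ≡⟨ cong (λ □ → ((𝟎 ⇒ x) ⇒ □) ′) (involution 𝟎) ⟩
    (𝟎 ⇒ x) ′ ′
      ≡⟨ involution (𝟎 ⇒ x) ⟩
    𝟎 ⇒ x ∎

  ⇒-neg-self′ : ∀ x → x ≡ (x ⇒ x ′) ′
  ⇒-neg-self′ x = begin
    x
      ≡⟨ sym (𝟎′-unit x) ⟩
    𝟎 ′ ⇒ x
      ≡⟨ cong (λ □ → □ ⇒ x) (sym 𝟎⇒𝟎′) ⟩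
    (𝟎 ⇒ 𝟎 ′) ⇒ x
      ≡⟨ I-𝟎′-middle 𝟎 x ⟩
    (x ′ ′ ⇒ x ′) ′
      ≡⟨ cong (λ □ → (□ ⇒ x ′) ′) (involution x) ⟩
    (x ⇒ x ′) ′ ∎

  neg-⇒-self′ : ∀ x → x ′ ≡ (x ′ ⇒ x) ′
  neg-⇒-self′ x = begin
    x ′
      ≡⟨ ⇒-neg-self′ (x ′) ⟩
    (x ′ ⇒ x ′ ′) ′
      ≡⟨ cong (λ □ → (x ′ ⇒ □) ′) (involution x) ⟩
    (x ′ ⇒ x) ′ ∎

  ⇒-neg-self : ∀ x → x ⇒ x ′ ≡ x ′
  ⇒-neg-self x = begin
    x ⇒ x ′
      ≡⟨ cong (λ □ → □ ⇒ x ′) (sym (involution x)) ⟩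
    x ′ ′ ⇒ x ′
      ≡⟨ sym (involution (x ′ ′ ⇒ x ′)) ⟩
    (x ′ ′ ⇒ x ′) ′ ′
      ≡⟨ cong _′ (sym (neg-⇒-self′ (x ′))) ⟩
    x ′ ′ ′
      ≡⟨ involution (x ′) ⟩
    x ′ ∎

  ⇒-neg-right : ∀ x y → (x ⇒ y) ⇒ y ′ ≡ ((y ⇒ x) ⇒ y) ′
  ⇒-neg-right x y = begin
    (x ⇒ y) ⇒ y ′
      ≡⟨ identityI x y (y ′) ⟩
    ((y ′ ′ ⇒ x) ⇒ (y ⇒ y ′) ′) ′
      ≡⟨ cong (λ □ → ((□ ⇒ x) ⇒ (y ⇒ y ′) ′) ′) (involution y) ⟩
    ((y ⇒ x) ⇒ (y ⇒ y ′) ′) ′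
      ≡⟨ cong (λ □ → ((y ⇒ x) ⇒ □) ′) (sym (⇒-neg-self′ y)) ⟩
    ((y ⇒ x) ⇒ y) ′ ∎

  left-absorb′ : ∀ x y → (x ⇒ y) ⇒ x ≡ (x ⇒ (y ⇒ x) ′) ′
  left-absorb′ x y = begin
    (x ⇒ y) ⇒ x
      ≡⟨ identityI x y x ⟩
    ((x ′ ⇒ x) ⇒ (y ⇒ x) ′) ′
      ≡⟨ cong (λ □ → ((x ′ ⇒ □) ⇒ (y ⇒ x) ′) ′) (sym (involution x)) ⟩
    ((x ′ ⇒ x ′ ′) ⇒ (y ⇒ x) ′) ′
      ≡⟨ cong (λ □ → (□ ⇒ (y ⇒ x) ′) ′) (⇒-neg-self (x ′)) ⟩
    (x ′ ′ ⇒ (y ⇒ x) ′) ′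
      ≡⟨ cong (λ □ → (□ ⇒ (y ⇒ x) ′) ′) (involution x) ⟩
    (x ⇒ (y ⇒ x) ′) ′ ∎

  left-absorb : ∀ x y → (x ⇒ y) ⇒ x ≡ (𝟎 ⇒ y) ⇒ x
  left-absorb x y = begin
    (x ⇒ y) ⇒ x
      ≡⟨ left-absorb′ x y ⟩
    (x ⇒ (y ⇒ x) ′) ′
      ≡⟨ sym (I-𝟎ˡ y x) ⟩
    (𝟎 ⇒ y) ⇒ x ∎

  𝟎⇒-⇒𝟎′ : ∀ x → (𝟎 ⇒ x) ⇒ 𝟎 ′ ≡ x ⇒ 𝟎 ′
  𝟎⇒-⇒𝟎′ x = begin
    (𝟎 ⇒ x) ⇒ 𝟎 ′
      ≡⟨ sym (left-absorb (𝟎 ′) x) ⟩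
    (𝟎 ′ ⇒ x) ⇒ 𝟎 ′
      ≡⟨ cong (λ □ → (𝟎 ′ ⇒ x) ⇒ □) (sym (involution (𝟎 ′))) ⟩
    (𝟎 ′ ⇒ x) ⇒ 𝟎 ′ ′ ′
      ≡⟨ I-reversed 𝟎 x (𝟎 ′) ⟩
    (x ⇒ 𝟎 ′) ′ ′
      ≡⟨ involution (x ⇒ 𝟎 ′) ⟩
    x ⇒ 𝟎 ′ ∎

  left-absorb-neg : ∀ x y → x ⇒ (y ⇒ x) ′ ≡ ((x ⇒ y) ⇒ x) ′
  left-absorb-neg x y = begin
    x ⇒ (y ⇒ x) ′
      ≡⟨ sym (involution (x ⇒ (y ⇒ x) ′)) ⟩
    (x ⇒ (y ⇒ x) ′) ′ ′
      ≡⟨ cong _′ (sym (left-absorb′ x y)) ⟩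
    ((x ⇒ y) ⇒ x) ′ ∎

  ⇒𝟎′-left : ∀ x y → (x ⇒ 𝟎 ′) ⇒ y ≡ ((𝟎 ⇒ x) ⇒ y ′) ′
  ⇒𝟎′-left x y = begin
    (x ⇒ 𝟎 ′) ⇒ y
      ≡⟨ I-𝟎′-middle x y ⟩
    ((y ′ ⇒ x) ⇒ y ′) ′
      ≡⟨ cong _′ (left-absorb (y ′) x) ⟩
    ((𝟎 ⇒ x) ⇒ y ′) ′ ∎

  𝟎⇒-left-neg : ∀ x y → (𝟎 ⇒ x) ⇒ y ′ ≡ ((x ⇒ 𝟎 ′) ⇒ y) ′
  𝟎⇒-left-neg x y = begin
    (𝟎 ⇒ x) ⇒ y ′
      ≡⟨ sym (involution ((𝟎 ⇒ x) ⇒ y ′)) ⟩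
    ((𝟎 ⇒ x) ⇒ y ′) ′ ′
      ≡⟨ cong _′ (sym (⇒𝟎′-left x y)) ⟩
    ((x ⇒ 𝟎 ′) ⇒ y) ′ ∎

  𝟎⇒neg-left : ∀ x y → ((𝟎 ⇒ x ′) ⇒ y) ′ ≡ (𝟎 ⇒ x) ⇒ y ′
  𝟎⇒neg-left x y = begin
    ((𝟎 ⇒ x ′) ⇒ y) ′
      ≡⟨ cong (λ □ → (□ ⇒ y) ′) (sym (contra-𝟎 (x ′))) ⟩
    ((x ′ ′ ⇒ 𝟎 ′) ⇒ y) ′
      ≡⟨ cong (λ □ → ((□ ⇒ 𝟎 ′) ⇒ y) ′) (involution x) ⟩
    ((x ⇒ 𝟎 ′) ⇒ y) ′
      ≡⟨ sym (𝟎⇒-left-neg x y) ⟩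
    (𝟎 ⇒ x) ⇒ y ′ ∎

  𝟎⇒-fixed : ∀ x → 𝟎 ⇒ x ≡ (𝟎 ⇒ x ′) ⇒ (𝟎 ⇒ x)
  𝟎⇒-fixed x = begin
    𝟎 ⇒ x
      ≡⟨ sym (𝟎′-unit (𝟎 ⇒ x)) ⟩
    𝟎 ′ ⇒ (𝟎 ⇒ x)
      ≡⟨ cong (λ □ → □ ⇒ (𝟎 ⇒ x)) (sym 𝟎⇒𝟎′) ⟩
    (𝟎 ⇒ 𝟎 ′) ⇒ (𝟎 ⇒ x)
      ≡⟨ sym (left-absorb (𝟎 ⇒ x) (𝟎 ′)) ⟩
    ((𝟎 ⇒ x) ⇒ 𝟎 ′) ⇒ (𝟎 ⇒ x)
      ≡⟨ cong (λ □ → □ ⇒ (𝟎 ⇒ x)) (𝟎⇒-⇒𝟎′ x) ⟩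
    (x ⇒ 𝟎 ′) ⇒ (𝟎 ⇒ x)
      ≡⟨ cong (λ □ → (□ ⇒ 𝟎 ′) ⇒ (𝟎 ⇒ x)) (sym (involution x)) ⟩
    (x ′ ′ ⇒ 𝟎 ′) ⇒ (𝟎 ⇒ x)
      ≡⟨ cong (λ □ → □ ⇒ (𝟎 ⇒ x)) (contra-𝟎 (x ′)) ⟩
    (𝟎 ⇒ x ′) ⇒ (𝟎 ⇒ x) ∎

  𝟎⇒-⇒𝟎′-neg : ∀ x → 𝟎 ⇒ (x ⇒ 𝟎 ′) ′ ≡ 𝟎 ⇒ x
  𝟎⇒-⇒𝟎′-neg x = begin
    𝟎 ⇒ (x ⇒ 𝟎 ′) ′
      ≡⟨ sym (contra-𝟎 ((x ⇒ 𝟎 ′) ′)) ⟩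
    (x ⇒ 𝟎 ′) ′ ′ ⇒ 𝟎 ′
      ≡⟨ cong (λ □ → □ ⇒ 𝟎 ′) (involution (x ⇒ 𝟎 ′)) ⟩
    (x ⇒ 𝟎 ′) ⇒ 𝟎 ′
      ≡⟨ I-𝟎′-middle x (𝟎 ′) ⟩
    ((𝟎 ′ ′ ⇒ x) ⇒ 𝟎 ′ ′) ′
      ≡⟨ cong (λ □ → ((□ ⇒ x) ⇒ 𝟎 ′ ′) ′) (involution 𝟎) ⟩
    ((𝟎 ⇒ x) ⇒ 𝟎 ′ ′) ′
      ≡⟨ cong (λ □ → ((𝟎 ⇒ x) ⇒ □) ′) (involution 𝟎) ⟩
    (𝟎 ⇒ x) ′ ′
      ≡⟨ involution (𝟎 ⇒ x) ⟩
    𝟎 ⇒ x ∎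

  left-absorb-𝟎⇒ : ∀ x y → x ⇒ ((𝟎 ⇒ y) ⇒ x) ′ ≡ ((𝟎 ⇒ y) ⇒ x) ′
  left-absorb-𝟎⇒ x y = begin
    x ⇒ ((𝟎 ⇒ y) ⇒ x) ′
      ≡⟨ I-reversed-𝟎 x (𝟎 ⇒ y) ⟩
    ((𝟎 ⇒ (𝟎 ⇒ y)) ⇒ x) ′
      ≡⟨ cong (λ □ → (□ ⇒ x) ′) (sym (𝟎⇒-⇒𝟎′-neg (𝟎 ⇒ y))) ⟩
    ((𝟎 ⇒ ((𝟎 ⇒ y) ⇒ 𝟎 ′) ′) ⇒ x) ′
      ≡⟨ cong (λ □ → ((𝟎 ⇒ □) ⇒ x) ′) (sym (⇒𝟎′-left y 𝟎)) ⟩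
    ((𝟎 ⇒ (y ⇒ 𝟎 ′) ′) ⇒ x) ′
      ≡⟨ cong (λ □ → (□ ⇒ x) ′) (𝟎⇒-⇒𝟎′-neg y) ⟩
    ((𝟎 ⇒ y) ⇒ x) ′ ∎

  ⇒neg-left : ∀ x y → (x ⇒ y ′) ⇒ y ≡ (x ⇒ 𝟎 ′) ⇒ y
  ⇒neg-left x y = begin
    (x ⇒ y ′) ⇒ y
      ≡⟨ cong (λ □ → (x ⇒ y ′) ⇒ □) (sym (involution y)) ⟩
    (x ⇒ y ′) ⇒ y ′ ′
      ≡⟨ ⇒-neg-right x (y ′) ⟩
    ((y ′ ⇒ x) ⇒ y ′) ′
      ≡⟨ sym (I-𝟎′-middle x y) ⟩
    (x ⇒ 𝟎 ′) ⇒ y ∎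

  ⇒𝟎′-prefix : ∀ x y → x ⇒ y ≡ (y ⇒ 𝟎 ′) ⇒ (x ⇒ y)
  ⇒𝟎′-prefix x y = begin
    x ⇒ y
      ≡⟨ sym (involution (x ⇒ y)) ⟩
    (x ⇒ y) ′ ′
      ≡⟨ sym (I-reversed 𝟎 x y) ⟩
    (𝟎 ′ ⇒ x) ⇒ y ′ ′
      ≡⟨ cong (λ □ → (𝟎 ′ ⇒ x) ⇒ □) (involution y) ⟩
    (𝟎 ′ ⇒ x) ⇒ y
      ≡⟨ identityI (𝟎 ′) x y ⟩
    ((y ′ ⇒ 𝟎 ′) ⇒ (x ⇒ y) ′) ′
      ≡⟨ cong (λ □ → (□ ⇒ (x ⇒ y) ′) ′) (contra-𝟎 y) ⟩
    ((𝟎 ⇒ y) ⇒ (x ⇒ y) ′) ′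
      ≡⟨ sym (⇒𝟎′-left y (x ⇒ y)) ⟩
    (y ⇒ 𝟎 ′) ⇒ (x ⇒ y) ∎

  𝟎⇒-prefix : ∀ x y → x ⇒ (𝟎 ⇒ y) ≡ (𝟎 ⇒ x) ⇒ (𝟎 ⇒ y)
  𝟎⇒-prefix x y = begin
    x ⇒ (𝟎 ⇒ y)
      ≡⟨ ⇒𝟎′-prefix x (𝟎 ⇒ y) ⟩
    ((𝟎 ⇒ y) ⇒ 𝟎 ′) ⇒ (x ⇒ (𝟎 ⇒ y))
      ≡⟨ cong (λ □ → □ ⇒ (x ⇒ (𝟎 ⇒ y))) (𝟎⇒-⇒𝟎′ y) ⟩
    (y ⇒ 𝟎 ′) ⇒ (x ⇒ (𝟎 ⇒ y))
      ≡⟨ ⇒𝟎′-left y (x ⇒ (𝟎 ⇒ y)) ⟩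
    ((𝟎 ⇒ y) ⇒ (x ⇒ (𝟎 ⇒ y)) ′) ′
      ≡⟨ sym (I-𝟎ˡ x (𝟎 ⇒ y)) ⟩
    (𝟎 ⇒ x) ⇒ (𝟎 ⇒ y) ∎

  cancel-𝟎⇒ : ∀ x y → ((𝟎 ⇒ x) ⇒ y) ⇒ x ≡ y ⇒ x
  cancel-𝟎⇒ x y = begin
    ((𝟎 ⇒ x) ⇒ y) ⇒ x
      ≡⟨ identityI (𝟎 ⇒ x) y x ⟩
    ((x ′ ⇒ (𝟎 ⇒ x)) ⇒ (y ⇒ x) ′) ′
      ≡⟨ cong (λ □ → ((□ ⇒ (𝟎 ⇒ x)) ⇒ (y ⇒ x) ′) ′) (neg-⇒-self′ x) ⟩
    (((x ′ ⇒ x) ′ ⇒ (𝟎 ⇒ x)) ⇒ (y ⇒ x) ′) ′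
      ≡⟨ cong (λ □ → ((□ ⇒ (𝟎 ⇒ x)) ⇒ (y ⇒ x) ′) ′) (sym (⇒-neg-right 𝟎 x)) ⟩
    ((((𝟎 ⇒ x) ⇒ x ′) ⇒ (𝟎 ⇒ x)) ⇒ (y ⇒ x) ′) ′
      ≡⟨ cong (λ □ → (□ ⇒ (y ⇒ x) ′) ′) (left-absorb (𝟎 ⇒ x) (x ′)) ⟩
    (((𝟎 ⇒ x ′) ⇒ (𝟎 ⇒ x)) ⇒ (y ⇒ x) ′) ′
      ≡⟨ cong (λ □ → (□ ⇒ (y ⇒ x) ′) ′) (sym (𝟎⇒-fixed x)) ⟩
    ((𝟎 ⇒ x) ⇒ (y ⇒ x) ′) ′
      ≡⟨ sym (⇒𝟎′-left x (y ⇒ x)) ⟩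
    (x ⇒ 𝟎 ′) ⇒ (y ⇒ x)
      ≡⟨ sym (⇒𝟎′-prefix y x) ⟩
    y ⇒ x ∎

  𝟎⇒-neg-⇒ : ∀ x y → 𝟎 ⇒ (x ′ ⇒ y) ′ ≡ x ⇒ (𝟎 ⇒ y ′)
  𝟎⇒-neg-⇒ x y = begin
    𝟎 ⇒ (x ′ ⇒ y) ′
      ≡⟨ sym (contra-𝟎 ((x ′ ⇒ y) ′)) ⟩
    (x ′ ⇒ y) ′ ′ ⇒ 𝟎 ′
      ≡⟨ cong (λ □ → □ ⇒ 𝟎 ′) (involution (x ′ ⇒ y)) ⟩
    (x ′ ⇒ y) ⇒ 𝟎 ′
      ≡⟨ identityI (x ′) y (𝟎 ′) ⟩
    ((𝟎 ′ ′ ⇒ x ′) ⇒ (y ⇒ 𝟎 ′) ′) ′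
      ≡⟨ cong (λ □ → ((□ ⇒ x ′) ⇒ (y ⇒ 𝟎 ′) ′) ′) (involution 𝟎) ⟩
    ((𝟎 ⇒ x ′) ⇒ (y ⇒ 𝟎 ′) ′) ′
      ≡⟨ sym (⇒𝟎′-left (x ′) (y ⇒ 𝟎 ′)) ⟩
    (x ′ ⇒ 𝟎 ′) ⇒ (y ⇒ 𝟎 ′)
      ≡⟨ cong (λ □ → □ ⇒ (y ⇒ 𝟎 ′)) (contra-𝟎 x) ⟩
    (𝟎 ⇒ x) ⇒ (y ⇒ 𝟎 ′)
      ≡⟨ cong (λ □ → (𝟎 ⇒ x) ⇒ (□ ⇒ 𝟎 ′)) (sym (involution y)) ⟩
    (𝟎 ⇒ x) ⇒ (y ′ ′ ⇒ 𝟎 ′)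
      ≡⟨ cong (λ □ → (𝟎 ⇒ x) ⇒ □) (contra-𝟎 (y ′)) ⟩
    (𝟎 ⇒ x) ⇒ (𝟎 ⇒ y ′)
      ≡⟨ sym (𝟎⇒-prefix x (y ′)) ⟩
    x ⇒ (𝟎 ⇒ y ′) ∎

  𝟎⇒-𝟎⇒-left : ∀ x y → 𝟎 ⇒ ((𝟎 ⇒ x) ⇒ y ′) ≡ x ⇒ (𝟎 ⇒ y ′)
  𝟎⇒-𝟎⇒-left x y = begin
    𝟎 ⇒ ((𝟎 ⇒ x) ⇒ y ′)
      ≡⟨ cong (λ □ → 𝟎 ⇒ □) (𝟎⇒-left-neg x y) ⟩
    𝟎 ⇒ ((x ⇒ 𝟎 ′) ⇒ y) ′
      ≡⟨ cong (λ □ → 𝟎 ⇒ (□ ⇒ y) ′) (sym (involution (x ⇒ 𝟎 ′))) ⟩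
    𝟎 ⇒ ((x ⇒ 𝟎 ′) ′ ′ ⇒ y) ′
      ≡⟨ 𝟎⇒-neg-⇒ ((x ⇒ 𝟎 ′) ′) y ⟩
    (x ⇒ 𝟎 ′) ′ ⇒ (𝟎 ⇒ y ′)
      ≡⟨ 𝟎⇒-prefix ((x ⇒ 𝟎 ′) ′) (y ′) ⟩
    (𝟎 ⇒ (x ⇒ 𝟎 ′) ′) ⇒ (𝟎 ⇒ y ′)
      ≡⟨ cong (λ □ → □ ⇒ (𝟎 ⇒ y ′)) (𝟎⇒-⇒𝟎′-neg x) ⟩
    (𝟎 ⇒ x) ⇒ (𝟎 ⇒ y ′)
      ≡⟨ sym (𝟎⇒-prefix x (y ′)) ⟩
    x ⇒ (𝟎 ⇒ y ′) ∎

  neg-prefix-𝟎⇒ : ∀ x y → x ′ ⇒ (𝟎 ⇒ (y ⇒ x)) ≡ 𝟎 ⇒ (y ⇒ x)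
  neg-prefix-𝟎⇒ x y = begin
    x ′ ⇒ (𝟎 ⇒ (y ⇒ x))
      ≡⟨ cong (λ □ → x ′ ⇒ (𝟎 ⇒ □)) (sym (involution (y ⇒ x))) ⟩
    x ′ ⇒ (𝟎 ⇒ (y ⇒ x) ′ ′)
      ≡⟨ sym (𝟎⇒-𝟎⇒-left (x ′) ((y ⇒ x) ′)) ⟩
    𝟎 ⇒ ((𝟎 ⇒ x ′) ⇒ (y ⇒ x) ′ ′)
      ≡⟨ cong (λ □ → 𝟎 ⇒ ((𝟎 ⇒ x ′) ⇒ □)) (involution (y ⇒ x)) ⟩
    𝟎 ⇒ ((𝟎 ⇒ x ′) ⇒ (y ⇒ x))
      ≡⟨ cong (λ □ → 𝟎 ⇒ (□ ⇒ (y ⇒ x))) (sym (contra-𝟎 (x ′))) ⟩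
    𝟎 ⇒ ((x ′ ′ ⇒ 𝟎 ′) ⇒ (y ⇒ x))
      ≡⟨ cong (λ □ → 𝟎 ⇒ ((□ ⇒ 𝟎 ′) ⇒ (y ⇒ x))) (involution x) ⟩
    𝟎 ⇒ ((x ⇒ 𝟎 ′) ⇒ (y ⇒ x))
      ≡⟨ cong (λ □ → 𝟎 ⇒ □) (sym (⇒𝟎′-prefix y x)) ⟩
    𝟎 ⇒ (y ⇒ x) ∎

  𝟎⇒-comm : ∀ x y → x ⇒ (𝟎 ⇒ y) ≡ 𝟎 ⇒ (x ⇒ y)
  𝟎⇒-comm x y = begin
    x ⇒ (𝟎 ⇒ y)
      ≡⟨ cong (λ □ → x ⇒ (𝟎 ⇒ □)) (sym (involution y)) ⟩
    x ⇒ (𝟎 ⇒ y ′ ′)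
      ≡⟨ sym (𝟎⇒-𝟎⇒-left x (y ′)) ⟩
    𝟎 ⇒ ((𝟎 ⇒ x) ⇒ y ′ ′)
      ≡⟨ cong (λ □ → 𝟎 ⇒ ((𝟎 ⇒ x) ⇒ □)) (involution y) ⟩
    𝟎 ⇒ ((𝟎 ⇒ x) ⇒ y)
      ≡⟨ cong (λ □ → 𝟎 ⇒ □) (I-𝟎ˡ x y) ⟩
    𝟎 ⇒ (y ⇒ (x ⇒ y) ′) ′
      ≡⟨ cong (λ □ → 𝟎 ⇒ (□ ⇒ (x ⇒ y) ′) ′) (sym (involution y)) ⟩
    𝟎 ⇒ (y ′ ′ ⇒ (x ⇒ y) ′) ′
      ≡⟨ 𝟎⇒-neg-⇒ (y ′) ((x ⇒ y) ′) ⟩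
    y ′ ⇒ (𝟎 ⇒ (x ⇒ y) ′ ′)
      ≡⟨ cong (λ □ → y ′ ⇒ (𝟎 ⇒ □)) (involution (x ⇒ y)) ⟩
    y ′ ⇒ (𝟎 ⇒ (x ⇒ y))
      ≡⟨ neg-prefix-𝟎⇒ y x ⟩
    𝟎 ⇒ (x ⇒ y) ∎

  ⇒𝟎⇒-right : ∀ x y z → (x ⇒ y) ⇒ (𝟎 ⇒ z) ≡ (x ⇒ (𝟎 ⇒ y)) ⇒ (𝟎 ⇒ z)
  ⇒𝟎⇒-right x y z = begin
    (x ⇒ y) ⇒ (𝟎 ⇒ z)
      ≡⟨ 𝟎⇒-prefix (x ⇒ y) z ⟩
    (𝟎 ⇒ (x ⇒ y)) ⇒ (𝟎 ⇒ z)
      ≡⟨ cong (λ □ → □ ⇒ (𝟎 ⇒ z)) (sym (𝟎⇒-comm x y)) ⟩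
    (x ⇒ (𝟎 ⇒ y)) ⇒ (𝟎 ⇒ z) ∎

  𝟎⇒-swap-left : ∀ x y → (x ⇒ (𝟎 ⇒ y)) ⇒ y ′ ≡ ((𝟎 ⇒ x) ⇒ y) ⇒ y ′
  𝟎⇒-swap-left x y = begin
    (x ⇒ (𝟎 ⇒ y)) ⇒ y ′
      ≡⟨ cong (λ □ → (x ⇒ (𝟎 ⇒ □)) ⇒ y ′) (sym (involution y)) ⟩
    (x ⇒ (𝟎 ⇒ y ′ ′)) ⇒ y ′
      ≡⟨ cong (λ □ → □ ⇒ y ′) (sym (𝟎⇒-𝟎⇒-left x (y ′))) ⟩
    (𝟎 ⇒ ((𝟎 ⇒ x) ⇒ y ′ ′)) ⇒ y ′
      ≡⟨ cong (λ □ → (𝟎 ⇒ ((𝟎 ⇒ x) ⇒ □)) ⇒ y ′) (involution y) ⟩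
    (𝟎 ⇒ ((𝟎 ⇒ x) ⇒ y)) ⇒ y ′
      ≡⟨ sym (left-absorb (y ′) ((𝟎 ⇒ x) ⇒ y)) ⟩
    (y ′ ⇒ ((𝟎 ⇒ x) ⇒ y)) ⇒ y ′
      ≡⟨ cong (λ □ → (y ′ ⇒ ((𝟎 ⇒ x) ⇒ □)) ⇒ y ′) (sym (involution y)) ⟩
    (y ′ ⇒ ((𝟎 ⇒ x) ⇒ y ′ ′)) ⇒ y ′
      ≡⟨ cong (λ □ → (y ′ ⇒ □) ⇒ y ′) (sym (𝟎⇒neg-left x (y ′))) ⟩
    (y ′ ⇒ ((𝟎 ⇒ x ′) ⇒ y ′) ′) ⇒ y ′
      ≡⟨ cong (λ □ → □ ⇒ y ′) (left-absorb-𝟎⇒ (y ′) (x ′)) ⟩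
    ((𝟎 ⇒ x ′) ⇒ y ′) ′ ⇒ y ′
      ≡⟨ cong (λ □ → □ ⇒ y ′) (𝟎⇒neg-left x (y ′)) ⟩
    ((𝟎 ⇒ x) ⇒ y ′ ′) ⇒ y ′
      ≡⟨ cong (λ □ → ((𝟎 ⇒ x) ⇒ □) ⇒ y ′) (involution y) ⟩
    ((𝟎 ⇒ x) ⇒ y) ⇒ y ′ ∎

  𝟎⇒-insert : ∀ x y z → 𝟎 ⇒ ((x ⇒ y) ⇒ z) ≡ 𝟎 ⇒ ((x ⇒ (𝟎 ⇒ y)) ⇒ z)
  𝟎⇒-insert x y z = begin
    𝟎 ⇒ ((x ⇒ y) ⇒ z)
      ≡⟨ sym (𝟎⇒-comm (x ⇒ y) z) ⟩
    (x ⇒ y) ⇒ (𝟎 ⇒ z)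
      ≡⟨ ⇒𝟎⇒-right x y z ⟩
    (x ⇒ (𝟎 ⇒ y)) ⇒ (𝟎 ⇒ z)
      ≡⟨ 𝟎⇒-comm (x ⇒ (𝟎 ⇒ y)) z ⟩
    𝟎 ⇒ ((x ⇒ (𝟎 ⇒ y)) ⇒ z) ∎

  neg-absorb : ∀ x y → x ′ ⇒ (y ⇒ x) ≡ y ⇒ x
  neg-absorb x y = begin
    x ′ ⇒ (y ⇒ x)
      ≡⟨ sym (cancel-𝟎⇒ (y ⇒ x) (x ′)) ⟩
    ((𝟎 ⇒ (y ⇒ x)) ⇒ x ′) ⇒ (y ⇒ x)
      ≡⟨ cong (λ □ → (□ ⇒ x ′) ⇒ (y ⇒ x)) (sym (𝟎⇒-comm y x)) ⟩
    ((y ⇒ (𝟎 ⇒ x)) ⇒ x ′) ⇒ (y ⇒ x)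
      ≡⟨ cong (λ □ → □ ⇒ (y ⇒ x)) (𝟎⇒-swap-left y x) ⟩
    (((𝟎 ⇒ y) ⇒ x) ⇒ x ′) ⇒ (y ⇒ x)
      ≡⟨ cong (λ □ → □ ⇒ (y ⇒ x)) (⇒-neg-right (𝟎 ⇒ y) x) ⟩
    ((x ⇒ (𝟎 ⇒ y)) ⇒ x) ′ ⇒ (y ⇒ x)
      ≡⟨ cong (λ □ → □ ⇒ (y ⇒ x)) (sym (left-absorb-neg x (𝟎 ⇒ y))) ⟩
    (x ⇒ ((𝟎 ⇒ y) ⇒ x) ′) ⇒ (y ⇒ x)
      ≡⟨ cong (λ □ → □ ⇒ (y ⇒ x)) (left-absorb-𝟎⇒ x y) ⟩
    ((𝟎 ⇒ y) ⇒ x) ′ ⇒ (y ⇒ x)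
      ≡⟨ cong (λ □ → □ ⇒ (y ⇒ x)) (sym (I-reversed-𝟎 x y)) ⟩
    (x ⇒ (y ⇒ x) ′) ⇒ (y ⇒ x)
      ≡⟨ ⇒neg-left x (y ⇒ x) ⟩
    (x ⇒ 𝟎 ′) ⇒ (y ⇒ x)
      ≡⟨ sym (⇒𝟎′-prefix y x) ⟩
    y ⇒ x ∎

  I-right : ∀ x y z → ((x ⇒ y) ⇒ z) ⇒ y ≡ ((x ⇒ y) ⇒ (z ⇒ y) ′) ′
  I-right x y z = begin
    ((x ⇒ y) ⇒ z) ⇒ y
      ≡⟨ identityI (x ⇒ y) z y ⟩
    ((y ′ ⇒ (x ⇒ y)) ⇒ (z ⇒ y) ′) ′
      ≡⟨ cong (λ □ → (□ ⇒ (z ⇒ y) ′) ′) (neg-absorb y x) ⟩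
    ((x ⇒ y) ⇒ (z ⇒ y) ′) ′ ∎

  ⊑-intro : ∀ {x y} → y ⇒ x ′ ≡ x ′ → 𝟎 ⇒ (x ⇒ y ′) ≡ 𝟎 ⇒ x ′ → x ⊑ y
  ⊑-intro {x} {y} absorb 𝟎⇒-eq = begin
    (x ⇒ y ′) ′
      ≡⟨ sym (⇒-absorbs-𝟎⇒ (x ⇒ y ′)) ⟩
    (x ⇒ y ′) ⇒ (𝟎 ⇒ (x ⇒ y ′)) ′
      ≡⟨ cong (λ □ → (x ⇒ y ′) ⇒ □ ′) 𝟎⇒-eq ⟩
    (x ⇒ y ′) ⇒ (𝟎 ⇒ x ′) ′
      ≡⟨ cong (λ □ → (□ ⇒ y ′) ⇒ (𝟎 ⇒ x ′) ′) (sym (involution x)) ⟩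
    (x ′ ′ ⇒ y ′) ⇒ (𝟎 ⇒ x ′) ′
      ≡⟨ I-reversed (x ′) (y ′) 𝟎 ⟩
    (y ′ ′ ⇒ x ′) ′
      ≡⟨ cong (λ □ → (□ ⇒ x ′) ′) (involution y) ⟩
    (y ⇒ x ′) ′
      ≡⟨ cong _′ absorb ⟩
    x ′ ′
      ≡⟨ involution x ⟩
    x ∎

  module Below {x y : Carrier} (x⊑y : x ⊑ y) where

    ⊑-unfold : x ⇒ y ′ ≡ x ′
    ⊑-unfold = trans (sym (involution (x ⇒ y ′))) (cong _′ x⊑y)

    ⊑-I : ∀ z → (z ⇒ x) ⇒ y ′ ≡ ((y ⇒ z) ⇒ x) ′
    ⊑-I z = begin
      (z ⇒ x) ⇒ y ′
        ≡⟨ identityI z x (y ′) ⟩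
      ((y ′ ′ ⇒ z) ⇒ (x ⇒ y ′) ′) ′
        ≡⟨ cong (λ □ → ((□ ⇒ z) ⇒ (x ⇒ y ′) ′) ′) (involution y) ⟩
      ((y ⇒ z) ⇒ (x ⇒ y ′) ′) ′
        ≡⟨ cong (λ □ → ((y ⇒ z) ⇒ □) ′) x⊑y ⟩
      ((y ⇒ z) ⇒ x) ′ ∎

    -- (𝟎 ⇒ y ′) ⇒ x = x: left absorption turns it into (x ⇒ y ′) ⇒ x, where the
    -- hypothesis applies.
    𝟎⇒y′-⇒x : (𝟎 ⇒ y ′) ⇒ x ≡ x
    𝟎⇒y′-⇒x = begin
      (𝟎 ⇒ y ′) ⇒ x
        ≡⟨ sym (left-absorb x (y ′)) ⟩
      (x ⇒ y ′) ⇒ x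
        ≡⟨ cong (λ □ → □ ⇒ x) ⊑-unfold ⟩
      x ′ ⇒ x
        ≡⟨ cong (λ □ → x ′ ⇒ □) (sym (involution x)) ⟩
      x ′ ⇒ x ′ ′
        ≡⟨ ⇒-neg-self (x ′) ⟩
      x ′ ′
        ≡⟨ involution x ⟩
      x ∎

    ⊑-I-reversed : ∀ z → (y ⇒ z) ⇒ x ≡ ((z ⇒ x) ⇒ y ′) ′
    ⊑-I-reversed z = begin
      (y ⇒ z) ⇒ x
        ≡⟨ sym (involution ((y ⇒ z) ⇒ x)) ⟩
      ((y ⇒ z) ⇒ x) ′ ′
        ≡⟨ cong _′ (sym (⊑-I z)) ⟩
      ((z ⇒ x) ⇒ y ′) ′ ∎

    ⇒𝟎′-⇒y : (x ⇒ 𝟎 ′) ⇒ y ≡ y ′ ⇒ x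
    ⇒𝟎′-⇒y = begin
      (x ⇒ 𝟎 ′) ⇒ y
        ≡⟨ ⇒𝟎′-left x y ⟩
      ((𝟎 ⇒ x) ⇒ y ′) ′
        ≡⟨ cong _′ (⊑-I 𝟎) ⟩
      (y ′ ⇒ x) ′ ′
        ≡⟨ involution (y ′ ⇒ x) ⟩
      y ′ ⇒ x ∎

    y′⇒x-𝟎 : y ′ ⇒ x ≡ (𝟎 ⇒ x ′) ⇒ y
    y′⇒x-𝟎 = begin
      y ′ ⇒ x
        ≡⟨ sym ⇒𝟎′-⇒y ⟩
      (x ⇒ 𝟎 ′) ⇒ y
        ≡⟨ cong (λ □ → (□ ⇒ 𝟎 ′) ⇒ y) (sym (involution x)) ⟩
      (x ′ ′ ⇒ 𝟎 ′) ⇒ y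
        ≡⟨ cong (λ □ → □ ⇒ y) (contra-𝟎 (x ′)) ⟩
      (𝟎 ⇒ x ′) ⇒ y ∎

    ⇒𝟎′-⇒y-neg : (x ⇒ 𝟎 ′) ⇒ y ≡ x ′ ⇒ y
    ⇒𝟎′-⇒y-neg = begin
      (x ⇒ 𝟎 ′) ⇒ y
        ≡⟨ sym (⇒neg-left x y) ⟩
      (x ⇒ y ′) ⇒ y
        ≡⟨ cong (λ □ → □ ⇒ y) ⊑-unfold ⟩
      x ′ ⇒ y ∎

    ⊑-swap : y ′ ⇒ x ≡ x ′ ⇒ y
    ⊑-swap = begin
      y ′ ⇒ x
        ≡⟨ sym ⇒𝟎′-⇒y ⟩
      (x ⇒ 𝟎 ′) ⇒ y
        ≡⟨ ⇒𝟎′-⇒y-neg ⟩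
      x ′ ⇒ y ∎

    𝟎⇒x-⇒y′ : (𝟎 ⇒ x) ⇒ y ′ ≡ (x ′ ⇒ y) ′
    𝟎⇒x-⇒y′ = begin
      (𝟎 ⇒ x) ⇒ y ′
        ≡⟨ 𝟎⇒-left-neg x y ⟩
      ((x ⇒ 𝟎 ′) ⇒ y) ′
        ≡⟨ cong _′ ⇒𝟎′-⇒y-neg ⟩
      (x ′ ⇒ y) ′ ∎

    y⇒x⇒z-⇒x : ∀ z → (y ⇒ (x ⇒ z)) ⇒ x ≡ (y ⇒ (𝟎 ⇒ z)) ⇒ x
    y⇒x⇒z-⇒x z = begin
      (y ⇒ (x ⇒ z)) ⇒ x
        ≡⟨ ⊑-I-reversed (x ⇒ z) ⟩
      (((x ⇒ z) ⇒ x) ⇒ y ′) ′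
        ≡⟨ cong (λ □ → (□ ⇒ y ′) ′) (left-absorb x z) ⟩
      (((𝟎 ⇒ z) ⇒ x) ⇒ y ′) ′
        ≡⟨ sym (⊑-I-reversed (𝟎 ⇒ z)) ⟩
      (y ⇒ (𝟎 ⇒ z)) ⇒ x ∎

    ⊑-absorb : y ⇒ x ′ ≡ x ′
    ⊑-absorb = begin
      y ⇒ x ′
        ≡⟨ cong (λ □ → y ⇒ □) (sym ⊑-unfold) ⟩
      y ⇒ (x ⇒ y ′)
        ≡⟨ cong (λ □ → □ ⇒ (x ⇒ y ′)) (sym (involution y)) ⟩
      y ′ ′ ⇒ (x ⇒ y ′)
        ≡⟨ neg-absorb (y ′) x ⟩
      x ⇒ y ′
        ≡⟨ ⊑-unfold ⟩
      x ′ ∎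

    -- (z ⇒ y) ⇒ x ′ = x ⇒ (z ⇒ x) ′: identity (I) at the consequent x ′, where
    -- ⊑-absorb removes y.
    ⇒y-⇒x′ : ∀ z → (z ⇒ y) ⇒ x ′ ≡ x ⇒ (z ⇒ x) ′
    ⇒y-⇒x′ z = begin
      (z ⇒ y) ⇒ x ′
        ≡⟨ identityI z y (x ′) ⟩
      ((x ′ ′ ⇒ z) ⇒ (y ⇒ x ′) ′) ′
        ≡⟨ cong (λ □ → ((□ ⇒ z) ⇒ (y ⇒ x ′) ′) ′) (involution x) ⟩
      ((x ⇒ z) ⇒ (y ⇒ x ′) ′) ′
        ≡⟨ cong (λ □ → ((x ⇒ z) ⇒ □ ′) ′) ⊑-absorb ⟩
      ((x ⇒ z) ⇒ x ′ ′) ′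
        ≡⟨ cong (λ □ → ((x ⇒ z) ⇒ □) ′) (involution x) ⟩
      ((x ⇒ z) ⇒ x) ′
        ≡⟨ sym (left-absorb-neg x z) ⟩
      x ⇒ (z ⇒ x) ′ ∎

    x′⇒𝟎⇒y : x ′ ⇒ (𝟎 ⇒ y) ≡ 𝟎 ⇒ x
    x′⇒𝟎⇒y = begin
      x ′ ⇒ (𝟎 ⇒ y)
        ≡⟨ cong (λ □ → x ′ ⇒ (𝟎 ⇒ □)) (sym (involution y)) ⟩
      x ′ ⇒ (𝟎 ⇒ y ′ ′)
        ≡⟨ sym (𝟎⇒-neg-⇒ (x ′) (y ′)) ⟩
      𝟎 ⇒ (x ′ ′ ⇒ y ′) ′
        ≡⟨ cong (λ □ → 𝟎 ⇒ (□ ⇒ y ′) ′) (involution x) ⟩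
      𝟎 ⇒ (x ⇒ y ′) ′
        ≡⟨ cong (λ □ → 𝟎 ⇒ □) x⊑y ⟩
      𝟎 ⇒ x ∎

    𝟎⇒y⇒z-⇒x : ∀ z → (𝟎 ⇒ (y ⇒ z)) ⇒ x ≡ (𝟎 ⇒ z) ⇒ x
    𝟎⇒y⇒z-⇒x z = begin
      (𝟎 ⇒ (y ⇒ z)) ⇒ x
        ≡⟨ identityI 𝟎 (y ⇒ z) x ⟩
      (x ′ ′ ⇒ ((y ⇒ z) ⇒ x) ′) ′
        ≡⟨ cong (λ □ → (□ ⇒ ((y ⇒ z) ⇒ x) ′) ′) (involution x) ⟩
      (x ⇒ ((y ⇒ z) ⇒ x) ′) ′
        ≡⟨ cong _′ (sym (⇒y-⇒x′ (y ⇒ z))) ⟩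
      (((y ⇒ z) ⇒ y) ⇒ x ′) ′
        ≡⟨ cong (λ □ → (□ ⇒ x ′) ′) (left-absorb y z) ⟩
      (((𝟎 ⇒ z) ⇒ y) ⇒ x ′) ′
        ≡⟨ cong _′ (⇒y-⇒x′ (𝟎 ⇒ z)) ⟩
      (x ⇒ ((𝟎 ⇒ z) ⇒ x) ′) ′
        ≡⟨ cong _′ (left-absorb-𝟎⇒ x z) ⟩
      ((𝟎 ⇒ z) ⇒ x) ′ ′
        ≡⟨ involution ((𝟎 ⇒ z) ⇒ x) ⟩
      (𝟎 ⇒ z) ⇒ x ∎

    𝟎⇒-y⇒z⇒x : ∀ z → 𝟎 ⇒ ((y ⇒ z) ⇒ x) ≡ z ⇒ (𝟎 ⇒ x)
    𝟎⇒-y⇒z⇒x z = begin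
      𝟎 ⇒ ((y ⇒ z) ⇒ x)
        ≡⟨ sym (𝟎⇒-comm (y ⇒ z) x) ⟩
      (y ⇒ z) ⇒ (𝟎 ⇒ x)
        ≡⟨ cong (λ □ → (y ⇒ z) ⇒ (𝟎 ⇒ □)) (sym (involution x)) ⟩
      (y ⇒ z) ⇒ (𝟎 ⇒ x ′ ′)
        ≡⟨ sym (𝟎⇒-𝟎⇒-left (y ⇒ z) (x ′)) ⟩
      𝟎 ⇒ ((𝟎 ⇒ (y ⇒ z)) ⇒ x ′ ′)
        ≡⟨ cong (λ □ → 𝟎 ⇒ ((𝟎 ⇒ (y ⇒ z)) ⇒ □)) (involution x) ⟩
      𝟎 ⇒ ((𝟎 ⇒ (y ⇒ z)) ⇒ x)
        ≡⟨ cong (λ □ → 𝟎 ⇒ □) (𝟎⇒y⇒z-⇒x z) ⟩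
      𝟎 ⇒ ((𝟎 ⇒ z) ⇒ x)
        ≡⟨ cong (λ □ → 𝟎 ⇒ ((𝟎 ⇒ z) ⇒ □)) (sym (involution x)) ⟩
      𝟎 ⇒ ((𝟎 ⇒ z) ⇒ x ′ ′)
        ≡⟨ 𝟎⇒-𝟎⇒-left z (x ′) ⟩
      z ⇒ (𝟎 ⇒ x ′ ′)
        ≡⟨ cong (λ □ → z ⇒ (𝟎 ⇒ □)) (involution x) ⟩
      z ⇒ (𝟎 ⇒ x) ∎

    𝟎⇒-x′⇒y : ∀ z → 𝟎 ⇒ ((x ′ ⇒ y) ⇒ z) ≡ 𝟎 ⇒ (x ⇒ z)
    𝟎⇒-x′⇒y z = begin
      𝟎 ⇒ ((x ′ ⇒ y) ⇒ z)
        ≡⟨ sym (𝟎⇒-comm (x ′ ⇒ y) z) ⟩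
      (x ′ ⇒ y) ⇒ (𝟎 ⇒ z)
        ≡⟨ ⇒𝟎⇒-right (x ′) y z ⟩
      (x ′ ⇒ (𝟎 ⇒ y)) ⇒ (𝟎 ⇒ z)
        ≡⟨ cong (λ □ → □ ⇒ (𝟎 ⇒ z)) x′⇒𝟎⇒y ⟩
      (𝟎 ⇒ x) ⇒ (𝟎 ⇒ z)
        ≡⟨ sym (𝟎⇒-prefix x z) ⟩
      x ⇒ (𝟎 ⇒ z)
        ≡⟨ 𝟎⇒-comm x z ⟩
      𝟎 ⇒ (x ⇒ z) ∎

    𝟎⇒-neg-⇒x⇒y : ∀ z → 𝟎 ⇒ ((z ⇒ x) ′ ⇒ y) ≡ z ⇒ (𝟎 ⇒ x)
    𝟎⇒-neg-⇒x⇒y z = begin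
      𝟎 ⇒ ((z ⇒ x) ′ ⇒ y)
        ≡⟨ sym (𝟎⇒-comm ((z ⇒ x) ′) y) ⟩
      (z ⇒ x) ′ ⇒ (𝟎 ⇒ y)
        ≡⟨ cong (λ □ → (z ⇒ x) ′ ⇒ (𝟎 ⇒ □)) (sym (involution y)) ⟩
      (z ⇒ x) ′ ⇒ (𝟎 ⇒ y ′ ′)
        ≡⟨ sym (𝟎⇒-neg-⇒ ((z ⇒ x) ′) (y ′)) ⟩
      𝟎 ⇒ ((z ⇒ x) ′ ′ ⇒ y ′) ′
        ≡⟨ cong (λ □ → 𝟎 ⇒ (□ ⇒ y ′) ′) (involution (z ⇒ x)) ⟩
      𝟎 ⇒ ((z ⇒ x) ⇒ y ′) ′
        ≡⟨ cong (λ □ → 𝟎 ⇒ □) (sym (⊑-I-reversed z)) ⟩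
      𝟎 ⇒ ((y ⇒ z) ⇒ x)
        ≡⟨ 𝟎⇒-y⇒z⇒x z ⟩
      z ⇒ (𝟎 ⇒ x) ∎

    ⇒x′-⇒y : ∀ z → (x ⇒ (z ⇒ x) ′) ⇒ y ≡ (𝟎 ⇒ (z ⇒ x) ′) ⇒ y
    ⇒x′-⇒y z = begin
      (x ⇒ (z ⇒ x) ′) ⇒ y
        ≡⟨ identityI x ((z ⇒ x) ′) y ⟩
      ((y ′ ⇒ x) ⇒ ((z ⇒ x) ′ ⇒ y) ′) ′
        ≡⟨ cong (λ □ → (□ ⇒ ((z ⇒ x) ′ ⇒ y) ′) ′) ⊑-swap ⟩
      ((x ′ ⇒ y) ⇒ ((z ⇒ x) ′ ⇒ y) ′) ′
        ≡⟨ sym (I-right (x ′) y ((z ⇒ x) ′)) ⟩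
      ((x ′ ⇒ y) ⇒ (z ⇒ x) ′) ⇒ y
        ≡⟨ cong (λ □ → □ ⇒ y) (I-reversed x y z) ⟩
      ((y ⇒ z) ⇒ x) ′ ⇒ y
        ≡⟨ cong (λ □ → □ ⇒ y) (sym (⊑-I z)) ⟩
      ((z ⇒ x) ⇒ y ′) ⇒ y
        ≡⟨ ⇒neg-left (z ⇒ x) y ⟩
      ((z ⇒ x) ⇒ 𝟎 ′) ⇒ y
        ≡⟨ cong (λ □ → (□ ⇒ 𝟎 ′) ⇒ y) (sym (involution (z ⇒ x))) ⟩
      ((z ⇒ x) ′ ′ ⇒ 𝟎 ′) ⇒ y
        ≡⟨ cong (λ □ → □ ⇒ y) (contra-𝟎 ((z ⇒ x) ′)) ⟩
      (𝟎 ⇒ (z ⇒ x) ′) ⇒ y ∎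

  module Transitive {a b c : Carrier} (a⊑b : a ⊑ b) (b⊑c : b ⊑ c) where
    module AB = Below a⊑b
    module BC = Below b⊑c

    -- (𝟎 ⇒ c) ⇒ a ′ = a ′: both hypotheses are needed, through ⇒y-⇒x′ for a ⊑ b
    -- and 𝟎⇒y′-⇒x for b ⊑ c.
    𝟎⇒c⇒a′ : (𝟎 ⇒ c) ⇒ a ′ ≡ a ′
    𝟎⇒c⇒a′ = begin
      (𝟎 ⇒ c) ⇒ a ′
        ≡⟨ sym (𝟎⇒neg-left c a) ⟩
      ((𝟎 ⇒ c ′) ⇒ a) ′
        ≡⟨ sym (left-absorb-𝟎⇒ a (c ′)) ⟩
      a ⇒ ((𝟎 ⇒ c ′) ⇒ a) ′
        ≡⟨ sym (AB.⇒y-⇒x′ (𝟎 ⇒ c ′)) ⟩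
      ((𝟎 ⇒ c ′) ⇒ b) ⇒ a ′
        ≡⟨ cong (λ □ → □ ⇒ a ′) BC.𝟎⇒y′-⇒x ⟩
      b ⇒ a ′
        ≡⟨ AB.⊑-absorb ⟩
      a ′ ∎

    𝟎⇒-ac : 𝟎 ⇒ (a ⇒ c ′) ≡ 𝟎 ⇒ a ′
    𝟎⇒-ac = begin
      𝟎 ⇒ (a ⇒ c ′)
        ≡⟨ sym (AB.𝟎⇒-x′⇒y (c ′)) ⟩
      𝟎 ⇒ ((a ′ ⇒ b) ⇒ c ′)
        ≡⟨ cong (λ □ → 𝟎 ⇒ □) (BC.⊑-I (a ′)) ⟩
      𝟎 ⇒ ((c ⇒ a ′) ⇒ b) ′
        ≡⟨ cong (λ □ → 𝟎 ⇒ ((c ⇒ □) ⇒ b) ′) (sym AB.⊑-absorb) ⟩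
      𝟎 ⇒ ((c ⇒ (b ⇒ a ′)) ⇒ b) ′
        ≡⟨ cong (λ □ → 𝟎 ⇒ □ ′) (BC.y⇒x⇒z-⇒x (a ′)) ⟩
      𝟎 ⇒ ((c ⇒ (𝟎 ⇒ a ′)) ⇒ b) ′
        ≡⟨ cong (λ □ → 𝟎 ⇒ (□ ⇒ b) ′) (sym (𝟎⇒-𝟎⇒-left c a)) ⟩
      𝟎 ⇒ ((𝟎 ⇒ ((𝟎 ⇒ c) ⇒ a ′)) ⇒ b) ′
        ≡⟨ cong (λ □ → 𝟎 ⇒ ((𝟎 ⇒ □) ⇒ b) ′) 𝟎⇒c⇒a′ ⟩
      𝟎 ⇒ ((𝟎 ⇒ a ′) ⇒ b) ′
        ≡⟨ cong (λ □ → 𝟎 ⇒ □ ′) (sym AB.y′⇒x-𝟎) ⟩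
      𝟎 ⇒ (b ′ ⇒ a) ′
        ≡⟨ cong (λ □ → 𝟎 ⇒ □ ′) AB.⊑-swap ⟩
      𝟎 ⇒ (a ′ ⇒ b) ′
        ≡⟨ AB.𝟎⇒-x′⇒y 𝟎 ⟩
      𝟎 ⇒ a ′ ∎

    swap-ac : c ′ ⇒ a ≡ a ′ ⇒ c
    swap-ac = begin
      c ′ ⇒ a
        ≡⟨ identityI c 𝟎 a ⟩
      ((a ′ ⇒ c) ⇒ (𝟎 ⇒ a) ′) ′
        ≡⟨ cong (λ □ → ((a ′ ⇒ c) ⇒ □ ′) ′) (sym AB.x′⇒𝟎⇒y) ⟩
      ((a ′ ⇒ c) ⇒ (a ′ ⇒ (𝟎 ⇒ b)) ′) ′
        ≡⟨ cong (λ □ → ((a ′ ⇒ c) ⇒ □ ′) ′) (sym (BC.𝟎⇒-neg-⇒x⇒y (a ′))) ⟩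
      ((a ′ ⇒ c) ⇒ (𝟎 ⇒ ((a ′ ⇒ b) ′ ⇒ c)) ′) ′
        ≡⟨ cong (λ □ → ((a ′ ⇒ c) ⇒ (𝟎 ⇒ (□ ⇒ c)) ′) ′) (sym AB.𝟎⇒x-⇒y′) ⟩
      ((a ′ ⇒ c) ⇒ (𝟎 ⇒ (((𝟎 ⇒ a) ⇒ b ′) ⇒ c)) ′) ′
        ≡⟨ cong (λ □ → ((a ′ ⇒ c) ⇒ □ ′) ′) (𝟎⇒-insert (𝟎 ⇒ a) (b ′) c) ⟩
      ((a ′ ⇒ c) ⇒ (𝟎 ⇒ (((𝟎 ⇒ a) ⇒ (𝟎 ⇒ b ′)) ⇒ c)) ′) ′
        ≡⟨ cong (λ □ → ((a ′ ⇒ c) ⇒ (𝟎 ⇒ (□ ⇒ c)) ′) ′) (sym (𝟎⇒-prefix a (b ′))) ⟩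
      ((a ′ ⇒ c) ⇒ (𝟎 ⇒ ((a ⇒ (𝟎 ⇒ b ′)) ⇒ c)) ′) ′
        ≡⟨ cong (λ □ → ((a ′ ⇒ c) ⇒ □ ′) ′) (sym (𝟎⇒-insert a (b ′) c)) ⟩
      ((a ′ ⇒ c) ⇒ (𝟎 ⇒ ((a ⇒ b ′) ⇒ c)) ′) ′
        ≡⟨ cong (λ □ → ((a ′ ⇒ c) ⇒ (𝟎 ⇒ (□ ⇒ c)) ′) ′) AB.⊑-unfold ⟩
      ((a ′ ⇒ c) ⇒ (𝟎 ⇒ (a ′ ⇒ c)) ′) ′
        ≡⟨ cong _′ (⇒-absorbs-𝟎⇒ (a ′ ⇒ c)) ⟩
      (a ′ ⇒ c) ′ ′
        ≡⟨ involution (a ′ ⇒ c) ⟩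
      a ′ ⇒ c ∎

    absorb-ac : c ⇒ a ′ ≡ a ′
    absorb-ac = begin
      c ⇒ a ′
        ≡⟨ sym (cancel-𝟎⇒ (a ′) c) ⟩
      ((𝟎 ⇒ a ′) ⇒ c) ⇒ a ′
        ≡⟨ cong (λ □ → (□ ⇒ c) ⇒ a ′) (sym (AB.𝟎⇒-x′⇒y 𝟎)) ⟩
      ((𝟎 ⇒ (a ′ ⇒ b) ′) ⇒ c) ⇒ a ′
        ≡⟨ cong (λ □ → □ ⇒ a ′) (sym (BC.⇒x′-⇒y (a ′))) ⟩
      ((b ⇒ (a ′ ⇒ b) ′) ⇒ c) ⇒ a ′
        ≡⟨ cong (λ □ → (□ ⇒ c) ⇒ a ′) (sym (BC.⇒y-⇒x′ (a ′))) ⟩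
      (((a ′ ⇒ c) ⇒ b ′) ⇒ c) ⇒ a ′
        ≡⟨ cong (λ □ → □ ⇒ a ′) (I-right (a ′) c (b ′)) ⟩
      ((a ′ ⇒ c) ⇒ (b ′ ⇒ c) ′) ′ ⇒ a ′
        ≡⟨ cong (λ □ → (□ ⇒ (b ′ ⇒ c) ′) ′ ⇒ a ′) (sym swap-ac) ⟩
      ((c ′ ⇒ a) ⇒ (b ′ ⇒ c) ′) ′ ⇒ a ′
        ≡⟨ cong (λ □ → □ ⇒ a ′) (sym (identityI a (b ′) c)) ⟩
      ((a ⇒ b ′) ⇒ c) ⇒ a ′
        ≡⟨ cong (λ □ → (□ ⇒ c) ⇒ a ′) AB.⊑-unfold ⟩
      (a ′ ⇒ c) ⇒ a ′
        ≡⟨ left-absorb (a ′) c ⟩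
      (𝟎 ⇒ c) ⇒ a ′
        ≡⟨ 𝟎⇒c⇒a′ ⟩
      a ′ ∎

theorem3p8 : {ℓ : Level} (A : Zroupoid ℓ) → IsI₂₀ A →
    ∀ a b c → Zroupoid._⊑_ A a b → Zroupoid._⊑_ A b c → Zroupoid._⊑_ A a c
theorem3p8 A isI₂₀ a b c a⊑b b⊑c = ⊑-intro absorb-ac 𝟎⇒-ac
  where
    open I₂₀-Laws A isI₂₀
    open Transitive a⊑b b⊑c
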